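{- Let $G$ be a graph with maximum degree $\Delta(G)=\Delta$. Then for every integer $t\ge 2$, \[ \tau_t(G)\ \ge\ \left\lceil\frac{2t+1+\sqrt{1+4t(t-1)\Delta}}{2}\right\rceil\ >\ \sqrt{t(t-1)\Delta}. \]
   Context: All graphs are simple. For an integer $t\ge1$, a $t$-tone coloring of a graph $G$ is an assignment $f:V(G)\to\binom{C}{t}$ of a $t$-element subset of a color set $C$ to each vertex such that $|f(u)\cap f(v)|<d(u,v)$ for all distinct $u,v\in V(G)$, where $d(u,v)$ is the graph distance ($\infty$ if $u,v$ are in different components). The $t$-tone chromatic number $\tau_t(G)$ is the minimum $|C|$ over all $t$-tone colorings of $G$. -}

module Defs where

open import Data.Nat using (ℕ; zero; suc; _+_; _*_; _∸_; _≤_; _<_; _⊔_)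
open import Data.Bool using (Bool; true; false; if_then_else_)
open import Data.Fin using (Fin)
open import Data.Fin.Subset using (Subset; _∩_; ∣_∣)
open import Data.List using (List; map; foldr; allFin)
open import Data.Nat.ListAction using (sum)
open import Data.Product using (Σ; ∃; _×_)
open import Relation.Binary.PropositionalEquality using (_≡_)
open import Relation.Nullary using (¬_)

record Graph (n : ℕ) : Set where
  field
    adj    : Fin n → Fin n → Bool
    sym    : ∀ u v → adj u v ≡ adj v u
    irrefl : ∀ v → adj v v ≡ false
open Graph public

degree : ∀ {n} → Graph n → Fin n → ℕ
degree G v = sum (map (λ w → if adj G v w then 1 else 0) (allFin _))

maxDegree : ∀ {n} → Graph n → ℕ
maxDegree G = foldr _⊔_ 0 (map (degree G) (allFin _))

data Walk {n : ℕ} (G : Graph n) : ℕ → Fin n → Fin n → Set where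
  here : ∀ {u} → Walk G 0 u u
  step : ∀ {l u w v} → adj G u w ≡ true → Walk G l w v → Walk G (suc l) u v

DistLE : ∀ {n} → Graph n → ℕ → Fin n → Fin n → Set
DistLE G m u v = ∃ λ l → l ≤ m × Walk G l u v

-- t-tone colouring with colour set Fin k:  |f(u) ∩ f(v)| < d(u,v)
-- for distinct u,v, i.e. NOT d(u,v) ≤ |f(u) ∩ f(v)|  (d = ∞ allowed)
record ToneColoring {n : ℕ} (G : Graph n) (t k : ℕ) : Set where
  field
    col     : Fin n → Subset k
    size    : ∀ v → ∣ col v ∣ ≡ t
    proper  : ∀ u v → ¬ (u ≡ v) → ¬ DistLE G ∣ col u ∩ col v ∣ u v

TauGE : ∀ {n} → Graph n → ℕ → ℕ → Set
TauGE G t c = ∀ k → ToneColoring G t k → c ≤ k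

-- c ≥ (2t+1+√(1+4t(t-1)Δ))/2, stated over ℕ:
--   2c ≥ 2t+1  and  (2c-2t-1)² ≥ 1+4t(t-1)Δ
AboveBound : ℕ → ℕ → ℕ → Set
AboveBound t Δ c =
  (2 * t + 1 ≤ 2 * c) ×
  (1 + 4 * t * (t ∸ 1) * Δ ≤ (2 * c ∸ (2 * t + 1)) * (2 * c ∸ (2 * t + 1)))

-- c = ⌈(2t+1+√(1+4t(t-1)Δ))/2⌉ : the least natural number above the bound
IsCeilBound : ℕ → ℕ → ℕ → Set
IsCeilBound t Δ c = AboveBound t Δ c × (∀ c' → AboveBound t Δ c' → c ≤ c')

-- Let v be a vertex of maximum degree Δ in a graph with a t-tone colouring using
-- k colours, and let m = k − t be the number of colours missing from v.  A neighbour
-- of v is at distance 1 from it, so its t colours are among those m; two neighbours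
-- are at distance at most 2, so they share at most one colour.  Hence no ordered
-- pair of distinct colours is used by two different neighbours, which gives
-- Δ t(t − 1) ≤ m(m − 1).  Solving this quadratic inequality for k = t + m is the bound.
module Submission where

open import Defs
open import Data.Nat using (ℕ; zero; suc; _+_; _*_; _∸_; _≤_; _<_; z≤n; s≤s)
open import Data.Product using (_×_; ∃; _,_)
open import Algebra.Properties.CommutativeSemigroup using (x∙yz≈y∙xz)
open import Data.Bool using (Bool; true; false; if_then_else_; _∧_; not)
open import Data.Bool.Properties using (∧-conicalˡ; ∧-conicalʳ)
open import Data.Empty using (⊥-elim)
open import Data.Fin using (Fin; zero; suc; _≟_)
open import Data.Fin.Properties using (0≢1+n; suc-injective)
open import Data.Fin.Subset using (Subset; ∣_∣; _∩_; _∈_; _⊆_; ∁)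
open import Data.Fin.Subset.Properties
  using (x∈p⇒∣p-x∣<∣p∣; x∈p∧x≢y⇒x∈p-y; x∈p∩q⁺; x∉p⇒x∈∁p; ∣∁p∣≡n∸∣p∣; ∣p∣≤n)
open import Data.List using (allFin; tabulate) renaming (map to mapᴸ)
open import Data.List.Membership.Propositional.Properties using (foldr-selective; ∈-map⁻)
open import Data.List.Properties using (map-tabulate)
open import Data.Nat.ListAction using () renaming (sum to sumᴸ)
open import Data.Nat.Properties
  using (+-*-semiring; *-commutativeSemigroup; module ≤-Reasoning; ⊔-sel
        ; +-assoc; +-comm; +-identityʳ; *-identityˡ; *-identityʳ; *-distribˡ-∸
        ; ≤-reflexive; ≤-trans; ≤-<-trans; ≤-pred; <⇒≱; ≰⇒>; n<1+n; m≤m+n; m∸n≤m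
        ; +-mono-≤; +-monoʳ-≤; *-mono-≤; *-monoʳ-≤; ∸-monoˡ-≤; *-cancelˡ-<
        ; m+n∸n≡m; m+n∸m≡n; m+[n∸m]≡n)
open import Data.Nat.Solver using (module +-*-Solver)
open import Data.Sum using (inj₁; inj₂)
open import Data.Vec using ([]; _∷_; lookup)
open import Data.Vec.Properties using (lookup⇒[]=; []=⇒lookup)
open import Function using (_∘_)
open import Relation.Binary.PropositionalEquality as ≡ using (_≡_; _≢_; refl; cong; cong₂; subst)
open import Relation.Nullary using (does; yes; no)
open import Algebra.Properties.Semiring.Sum +-*-semiring
  using (sum; sum-syntax; sum-cong-≗; ∑-distrib-+; ∑-comm; *-distribˡ-sum; *-distribʳ-sum)

open +-*-Solver

[_] : Bool → ℕ
[ b ] = if b then 1 else 0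

[∧] : ∀ a b → [ a ∧ b ] ≡ [ a ] * [ b ]
[∧] true  b = ≡.sym (+-identityʳ [ b ])
[∧] false b = refl

[b]*[b]≡[b] : ∀ b → [ b ] * [ b ] ≡ [ b ]
[b]*[b]≡[b] true  = refl
[b]*[b]≡[b] false = refl

∑-mono-≤ : ∀ {n} {f g : Fin n → ℕ} → (∀ i → f i ≤ g i) → sum f ≤ sum g
∑-mono-≤ {zero}  f≤g = z≤n
∑-mono-≤ {suc n} f≤g = +-mono-≤ (f≤g zero) (∑-mono-≤ (f≤g ∘ suc))

∑-zero : ∀ {n} {f : Fin n → ℕ} → (∀ i → f i ≡ 0) → sum f ≡ 0
∑-zero {zero}  f≡0 = refl
∑-zero {suc n} f≡0 = cong₂ _+_ (f≡0 zero) (∑-zero (f≡0 ∘ suc))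

∑-unique-≤ : ∀ {n} (P : Fin n → Bool) (b : Bool) →
  (∀ {i} → P i ≡ true → b ≡ true) →
  (∀ {i j} → P i ≡ true → P j ≡ true → i ≡ j) →
  ∑[ i < n ] [ P i ] ≤ [ b ]
∑-unique-≤ {zero} P b P⇒b unique = z≤n
∑-unique-≤ {suc n} P b P⇒b unique with P zero in P₀
... | false = ∑-unique-≤ (P ∘ suc) b P⇒b (λ p q → suc-injective (unique p q))
... | true rewrite P⇒b P₀ = s≤s (≤-reflexive (∑-zero none))
  where
  none : ∀ i → [ P (suc i) ] ≡ 0
  none i with P (suc i) in Pᵢ
  ... | true  = ⊥-elim (0≢1+n (unique P₀ Pᵢ))
  ... | false = refl

sumᴸ-map-allFin : ∀ n (f : Fin n → ℕ) → sumᴸ (mapᴸ f (allFin n)) ≡ ∑[ i < n ] f i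
sumᴸ-map-allFin n f = ≡.trans (cong sumᴸ (map-tabulate (λ i → i) f)) (sumᴸ-tabulate n f)
  where
  sumᴸ-tabulate : ∀ n (f : Fin n → ℕ) → sumᴸ (tabulate f) ≡ ∑[ i < n ] f i
  sumᴸ-tabulate zero    f = refl
  sumᴸ-tabulate (suc n) f = cong (f zero +_) (sumᴸ-tabulate n (f ∘ suc))

_≢ᵇ_ : ∀ {k} → Fin k → Fin k → Bool
x ≢ᵇ y = not (does (x ≟ y))

∑-punctured : ∀ {k} (x : Fin k) (g : Fin k → ℕ) → ∑[ y < k ] ([ x ≢ᵇ y ] * g y) + g x ≡ sum g
∑-punctured {suc k} zero g = ≡.trans
  (cong (_+ g zero) (sum-cong-≗ (λ y → *-identityˡ (g (suc y)))))
  (+-comm _ (g zero))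
∑-punctured {suc k} (suc x) g = begin
  1 * g zero + ∑[ y < k ] ([ x ≢ᵇ y ] * g (suc y)) + g (suc x)
    ≡⟨ +-assoc (1 * g zero) _ _ ⟩
  1 * g zero + (∑[ y < k ] ([ x ≢ᵇ y ] * g (suc y)) + g (suc x))
    ≡⟨ cong₂ _+_ (*-identityˡ (g zero)) (∑-punctured x (g ∘ suc)) ⟩
  g zero + sum (g ∘ suc) ∎
  where open ≡.≡-Reasoning

offDiagonal : ∀ {k} → (Fin k → ℕ) → ℕ
offDiagonal {k} a = ∑[ x < k ] ∑[ y < k ] ([ x ≢ᵇ y ] * (a x * a y))

offDiagonal+diagonal : ∀ {k} (a : Fin k → ℕ) →
  offDiagonal a + ∑[ x < k ] (a x * a x) ≡ sum a * sum a
offDiagonal+diagonal {k} a = begin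
  offDiagonal a + ∑[ x < k ] (a x * a x)
    ≡⟨ ≡.sym (∑-distrib-+ (λ x → ∑[ y < k ] ([ x ≢ᵇ y ] * (a x * a y))) (λ x → a x * a x)) ⟩
  ∑[ x < k ] (∑[ y < k ] ([ x ≢ᵇ y ] * (a x * a y)) + a x * a x)
    ≡⟨ sum-cong-≗ (λ x → ∑-punctured x (λ y → a x * a y)) ⟩
  ∑[ x < k ] ∑[ y < k ] (a x * a y)
    ≡⟨ sum-cong-≗ (λ x → ≡.sym (*-distribˡ-sum (a x) a)) ⟩
  ∑[ x < k ] (a x * sum a)
    ≡⟨ ≡.sym (*-distribʳ-sum (sum a) a) ⟩
  sum a * sum a ∎
  where open ≡.≡-Reasoning

∣p∣≡∑ : ∀ {k} (p : Subset k) → ∣ p ∣ ≡ ∑[ x < k ] [ lookup p x ]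
∣p∣≡∑ []          = refl
∣p∣≡∑ (true ∷ p)  = cong suc (∣p∣≡∑ p)
∣p∣≡∑ (false ∷ p) = ∣p∣≡∑ p

∣p∣+∣∁p∣≡n : ∀ {k} (p : Subset k) → ∣ p ∣ + ∣ ∁ p ∣ ≡ k
∣p∣+∣∁p∣≡n p rewrite ∣∁p∣≡n∸∣p∣ p = m+[n∸m]≡n (∣p∣≤n p)

x∈p⇒0<∣p∣ : ∀ {k} {x : Fin k} {p : Subset k} → x ∈ p → 0 < ∣ p ∣
x∈p⇒0<∣p∣ x∈p = ≤-<-trans z≤n (x∈p⇒∣p-x∣<∣p∣ x∈p)

x∈p∧y∈p⇒2≤∣p∣ : ∀ {k} {x y : Fin k} {p : Subset k} → x ≢ y → x ∈ p → y ∈ p → 2 ≤ ∣ p ∣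
x∈p∧y∈p⇒2≤∣p∣ x≢y x∈p y∈p =
  ≤-trans (s≤s (x∈p⇒0<∣p∣ (x∈p∧x≢y⇒x∈p-y y∈p (x≢y ∘ ≡.sym)))) (x∈p⇒∣p-x∣<∣p∣ x∈p)

pairs : ∀ {k} → Subset k → ℕ
pairs p = ∣ p ∣ * (∣ p ∣ ∸ 1)

pairs≡offDiagonal : ∀ {k} (p : Subset k) → pairs p ≡ offDiagonal (λ x → [ lookup p x ])
pairs≡offDiagonal {k} p = begin
  ∣ p ∣ * (∣ p ∣ ∸ 1)      ≡⟨ *-distribˡ-∸ ∣ p ∣ ∣ p ∣ 1 ⟩
  ∣ p ∣ * ∣ p ∣ ∸ ∣ p ∣ * 1 ≡⟨ cong₂ _∸_ (≡.sym square) (*-identityʳ ∣ p ∣) ⟩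
  off + ∣ p ∣ ∸ ∣ p ∣       ≡⟨ m+n∸n≡m off ∣ p ∣ ⟩
  off ∎
  where
  open ≡.≡-Reasoning
  χ : Fin k → ℕ
  χ x = [ lookup p x ]
  off : ℕ
  off = offDiagonal χ
  square : off + ∣ p ∣ ≡ ∣ p ∣ * ∣ p ∣
  square rewrite ∣p∣≡∑ p =
    ≡.trans (cong (off +_) (sum-cong-≗ (λ x → ≡.sym ([b]*[b]≡[b] (lookup p x)))))
            (offDiagonal+diagonal χ)

∑-offDiagonal : ∀ {n k} (c : Fin n → ℕ) (a : Fin n → Fin k → ℕ) →
  ∑[ w < n ] (c w * offDiagonal (a w))
    ≡ ∑[ x < k ] ∑[ y < k ] ([ x ≢ᵇ y ] * ∑[ w < n ] (c w * (a w x * a w y)))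
∑-offDiagonal {n} {k} c a = begin
  ∑[ w < n ] (c w * offDiagonal (a w))
    ≡⟨ sum-cong-≗ (λ w → ≡.trans (*-distribˡ-sum (c w) (λ x → ∑[ y < k ] term w x y))
                           (sum-cong-≗ (λ x → *-distribˡ-sum (c w) (term w x)))) ⟩
  ∑[ w < n ] ∑[ x < k ] ∑[ y < k ] (c w * term w x y)
    ≡⟨ ≡.trans (∑-comm (λ w x → ∑[ y < k ] (c w * term w x y)))
               (sum-cong-≗ (λ x → ∑-comm (λ w y → c w * term w x y))) ⟩
  ∑[ x < k ] ∑[ y < k ] ∑[ w < n ] (c w * term w x y)
    ≡⟨ sum-cong-≗ (λ x → sum-cong-≗ (λ y → ≡.trans
         (sum-cong-≗ (λ w → x∙yz≈y∙xz *-commutativeSemigroup (c w) [ x ≢ᵇ y ] _))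
         (≡.sym (*-distribˡ-sum [ x ≢ᵇ y ] (λ w → c w * (a w x * a w y)))))) ⟩
  ∑[ x < k ] ∑[ y < k ] ([ x ≢ᵇ y ] * ∑[ w < n ] (c w * (a w x * a w y))) ∎
  where
  open ≡.≡-Reasoning
  term : Fin n → Fin k → Fin k → ℕ
  term w x y = [ x ≢ᵇ y ] * (a w x * a w y)

-- Ordered pairs of distinct points in a set system whose members pairwise share at
-- most one point: each pair is covered at most once, and only if it lies in B.
∑-pairs-≤ : ∀ {n k} (e : Fin n → Bool) (A : Fin n → Subset k) (B : Subset k) →
  (∀ {w} → e w ≡ true → A w ⊆ B) →
  (∀ {w w'} → w ≢ w' → e w ≡ true → e w' ≡ true → ∣ A w ∩ A w' ∣ ≤ 1) →
  ∑[ w < n ] ([ e w ] * pairs (A w)) ≤ pairs B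
∑-pairs-≤ {n} {k} e A B A⊆B linear = begin
  ∑[ w < n ] ([ e w ] * pairs (A w))
    ≡⟨ sum-cong-≗ (λ w → cong ([ e w ] *_) (pairs≡offDiagonal (A w))) ⟩
  ∑[ w < n ] ([ e w ] * offDiagonal (χ w))
    ≡⟨ ∑-offDiagonal (λ w → [ e w ]) χ ⟩
  ∑[ x < k ] ∑[ y < k ] ([ x ≢ᵇ y ] * ∑[ w < n ] ([ e w ] * (χ w x * χ w y)))
    ≤⟨ ∑-mono-≤ (λ x → ∑-mono-≤ (λ y → pointwise x y)) ⟩
  ∑[ x < k ] ∑[ y < k ] ([ x ≢ᵇ y ] * ([ lookup B x ] * [ lookup B y ]))
    ≡⟨ ≡.sym (pairs≡offDiagonal B) ⟩
  pairs B ∎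
  where
  open ≤-Reasoning
  χ : Fin n → Fin k → ℕ
  χ w x = [ lookup (A w) x ]

  shares : Fin k → Fin k → Fin n → Bool
  shares x y w = e w ∧ (lookup (A w) x ∧ lookup (A w) y)

  [shares] : ∀ x y w → [ e w ] * (χ w x * χ w y) ≡ [ shares x y w ]
  [shares] x y w = ≡.sym (≡.trans ([∧] (e w) _) (cong ([ e w ] *_) ([∧] (lookup (A w) x) _)))

  module _ {x y w} (s : shares x y w ≡ true) where
    e-w : e w ≡ true
    e-w = ∧-conicalˡ _ _ s
    x∈A : x ∈ A w
    x∈A = lookup⇒[]= x (A w) (∧-conicalˡ _ (lookup (A w) y) (∧-conicalʳ (e w) _ s))
    y∈A : y ∈ A w
    y∈A = lookup⇒[]= y (A w) (∧-conicalʳ (lookup (A w) x) _ (∧-conicalʳ (e w) _ s))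

  shared-in-B : ∀ x y {w} → shares x y w ≡ true → lookup B x ∧ lookup B y ≡ true
  shared-in-B x y s rewrite []=⇒lookup (A⊆B (e-w s) (x∈A s)) = []=⇒lookup (A⊆B (e-w s) (y∈A s))

  shared-once : ∀ {x y} → x ≢ y → ∀ {w w'} → shares x y w ≡ true → shares x y w' ≡ true → w ≡ w'
  shared-once x≢y {w} {w'} s s' with w ≟ w'
  ... | yes w≡w' = w≡w'
  ... | no  w≢w' = ⊥-elim (<⇒≱ (s≤s (linear w≢w' (e-w s) (e-w s')))
          (x∈p∧y∈p⇒2≤∣p∣ x≢y (x∈p∩q⁺ (x∈A s , x∈A s')) (x∈p∩q⁺ (y∈A s , y∈A s'))))

  pointwise : ∀ x y → [ x ≢ᵇ y ] * ∑[ w < n ] ([ e w ] * (χ w x * χ w y))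
                    ≤ [ x ≢ᵇ y ] * ([ lookup B x ] * [ lookup B y ])
  pointwise x y with x ≟ y
  ... | yes _   = z≤n
  ... | no  x≢y = *-monoʳ-≤ 1 (begin
    ∑[ w < n ] ([ e w ] * (χ w x * χ w y)) ≡⟨ sum-cong-≗ ([shares] x y) ⟩
    ∑[ w < n ] [ shares x y w ]             ≤⟨ ∑-unique-≤ (shares x y) _ (shared-in-B x y) (shared-once x≢y) ⟩
    [ lookup B x ∧ lookup B y ]             ≡⟨ [∧] (lookup B x) (lookup B y) ⟩
    [ lookup B x ] * [ lookup B y ]         ∎)

-- With 1 + m spare colours the gap 2(t + 1 + m) − (2t + 1) is 2m + 1, and (2m + 1)² = 1 + 4(1 + m)m.
aboveBound : ∀ {t Δ m} → 2 ≤ t → 1 ≤ Δ → Δ * (t * (t ∸ 1)) ≤ m * (m ∸ 1) →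
  AboveBound t Δ (t + m)
aboveBound {t} {Δ} {zero} 2≤t 1≤Δ bound = ⊥-elim (<⇒≱ positive bound)
  where
  positive : 0 < Δ * (t * (t ∸ 1))
  positive = *-mono-≤ 1≤Δ (*-mono-≤ (≤-trans (s≤s z≤n) 2≤t) (∸-monoˡ-≤ 1 2≤t))
aboveBound {t} {Δ} {suc m} 2≤t 1≤Δ bound = 2t+1≤2c , square
  where
  double : 2 * (t + suc m) ≡ (2 * t + 1) + (2 * m + 1)
  double = solve 2 (λ t m → con 2 :* (t :+ (con 1 :+ m)) := (con 2 :* t :+ con 1) :+ (con 2 :* m :+ con 1))
                 refl t m

  2t+1≤2c : 2 * t + 1 ≤ 2 * (t + suc m)
  2t+1≤2c = subst (2 * t + 1 ≤_) (≡.sym double) (m≤m+n (2 * t + 1) (2 * m + 1))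

  gap : 2 * (t + suc m) ∸ (2 * t + 1) ≡ 2 * m + 1
  gap = ≡.trans (cong (_∸ (2 * t + 1)) double) (m+n∸m≡n (2 * t + 1) (2 * m + 1))

  square : 1 + 4 * t * (t ∸ 1) * Δ ≤ (2 * (t + suc m) ∸ (2 * t + 1)) * (2 * (t + suc m) ∸ (2 * t + 1))
  square rewrite gap = begin
    1 + 4 * t * (t ∸ 1) * Δ
      ≡⟨ cong suc (solve 3 (λ t s Δ → con 4 :* t :* s :* Δ := con 4 :* (Δ :* (t :* s))) refl t (t ∸ 1) Δ) ⟩
    1 + 4 * (Δ * (t * (t ∸ 1)))
      ≤⟨ +-monoʳ-≤ 1 (*-monoʳ-≤ 4 bound) ⟩
    1 + 4 * (suc m * m)
      ≡⟨ solve 1 (λ m → con 1 :+ con 4 :* ((con 1 :+ m) :* m) := (con 2 :* m :+ con 1) :* (con 2 :* m :+ con 1)) refl m ⟩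
    (2 * m + 1) * (2 * m + 1) ∎
    where open ≤-Reasoning

aboveBound⇒t*[t∸1]*Δ<c*c : ∀ {t Δ c} → AboveBound t Δ c → t * (t ∸ 1) * Δ < c * c
aboveBound⇒t*[t∸1]*Δ<c*c {t} {Δ} {c} (_ , square) = *-cancelˡ-< 4 _ _ (begin-strict
  4 * (t * (t ∸ 1) * Δ)   ≡⟨ solve 3 (λ t s Δ → con 4 :* (t :* s :* Δ) := con 4 :* t :* s :* Δ) refl t (t ∸ 1) Δ ⟩
  4 * t * (t ∸ 1) * Δ     <⟨ n<1+n _ ⟩
  1 + 4 * t * (t ∸ 1) * Δ ≤⟨ square ⟩
  gap * gap               ≤⟨ *-mono-≤ (m∸n≤m (2 * c) (2 * t + 1)) (m∸n≤m (2 * c) (2 * t + 1)) ⟩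
  2 * c * (2 * c)         ≡⟨ solve 1 (λ c → con 2 :* c :* (con 2 :* c) := con 4 :* (c :* c)) refl c ⟩
  4 * (c * c)             ∎)
  where
  open ≤-Reasoning
  gap : ℕ
  gap = 2 * c ∸ (2 * t + 1)

degree≡∑ : ∀ {n} (G : Graph n) (v : Fin n) → degree G v ≡ ∑[ w < n ] [ adj G v w ]
degree≡∑ {n} G v = sumᴸ-map-allFin n (λ w → [ adj G v w ])

maxDegree-attained : ∀ {n} (G : Graph n) → 1 ≤ maxDegree G → ∃ λ v → degree G v ≡ maxDegree G
maxDegree-attained {n} G 1≤Δ with foldr-selective ⊔-sel 0 (mapᴸ (degree G) (allFin n))
... | inj₁ Δ≡0 = ⊥-elim (<⇒≱ 1≤Δ (≤-reflexive Δ≡0))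
... | inj₂ Δ∈ with ∈-map⁻ (degree G) Δ∈
...   | v , _ , Δ≡deg = v , ≡.sym Δ≡deg

module _ {n t k} {G : Graph n} (f : ToneColoring G t k) where
  open ToneColoring f

  overlap<length : ∀ {l u v} → u ≢ v → Walk G l u v → ∣ col u ∩ col v ∣ < l
  overlap<length u≢v walk = ≰⇒> (λ l≤overlap → proper _ _ u≢v (_ , l≤overlap , walk))

  adjacent⇒≢ : ∀ {u v} → adj G u v ≡ true → u ≢ v
  adjacent⇒≢ {u} uv refl = false≢true (≡.trans (≡.sym (irrefl G u)) uv)
    where
    false≢true : false ≢ true
    false≢true ()

  neighbour-colours : ∀ {v w} → adj G v w ≡ true → col w ⊆ ∁ (col v)
  neighbour-colours vw x∈w = x∉p⇒x∈∁p λ x∈v →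
    <⇒≱ (overlap<length (adjacent⇒≢ vw) (step vw here)) (x∈p⇒0<∣p∣ (x∈p∩q⁺ (x∈v , x∈w)))

  common-neighbours-overlap : ∀ {v w w'} → w ≢ w' → adj G v w ≡ true → adj G v w' ≡ true →
    ∣ col w ∩ col w' ∣ ≤ 1
  common-neighbours-overlap {v} {w} w≢w' vw vw' =
    ≤-pred (overlap<length w≢w' (step (≡.trans (Graph.sym G w v) vw) (step vw' here)))

  neighbourhood-pairs-≤ : ∀ v → degree G v * (t * (t ∸ 1)) ≤ pairs (∁ (col v))
  neighbourhood-pairs-≤ v = begin
    degree G v * (t * (t ∸ 1))
      ≡⟨ cong (_* (t * (t ∸ 1))) (degree≡∑ G v) ⟩
    ∑[ w < n ] [ adj G v w ] * (t * (t ∸ 1))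
      ≡⟨ *-distribʳ-sum (t * (t ∸ 1)) (λ w → [ adj G v w ]) ⟩
    ∑[ w < n ] ([ adj G v w ] * (t * (t ∸ 1)))
      ≡⟨ sum-cong-≗ (λ w → cong (λ s → [ adj G v w ] * (s * (s ∸ 1))) (≡.sym (size w))) ⟩
    ∑[ w < n ] ([ adj G v w ] * pairs (col w))
      ≤⟨ ∑-pairs-≤ (adj G v) col (∁ (col v)) neighbour-colours common-neighbours-overlap ⟩
    pairs (∁ (col v)) ∎
    where open ≤-Reasoning

  colours-used : ∀ v → t + ∣ ∁ (col v) ∣ ≡ k
  colours-used v = ≡.trans (cong (_+ _) (≡.sym (size v))) (∣p∣+∣∁p∣≡n (col v))

  colours-aboveBound : ∀ v → 2 ≤ t → 1 ≤ degree G v → AboveBound t (degree G v) k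
  colours-aboveBound v 2≤t 1≤deg =
    subst (AboveBound t (degree G v)) (colours-used v) (aboveBound 2≤t 1≤deg (neighbourhood-pairs-≤ v))

mainTheorem1 : ∀ {n} (G : Graph n) (t : ℕ) → 2 ≤ t → 1 ≤ maxDegree G →
    ∀ c → IsCeilBound t (maxDegree G) c →
    TauGE G t c × (t * (t ∸ 1) * maxDegree G < c * c)
mainTheorem1 G t 2≤t 1≤Δ c (c-above , c-least) =
  τ≥c , aboveBound⇒t*[t∸1]*Δ<c*c {t} {maxDegree G} {c} c-above
  where
  τ≥c : TauGE G t c
  τ≥c k f with maxDegree-attained G 1≤Δ
  ... | v , deg≡Δ = c-least k (subst (λ Δ → AboveBound t Δ k) deg≡Δ
          (colours-aboveBound f v 2≤t (subst (1 ≤_) (≡.sym deg≡Δ) 1≤Δ)))
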